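{- Let $C>0$ and $\varepsilon>0$, and let $f(x)=C/(\log x\cdot(\log\log x)^2)$. If $G$ is an $n$-vertex $f$-non-expanding graph, then one can remove at most $\varepsilon n$ edges from $G$ so that each connected component of the remaining graph has at most $2^{2^{2(C/\varepsilon)+3}}$ vertices.
   Context: All logarithms are base $2$. For a graph $H$ and $S\subseteq V(H)$, $\partial_H(S)$ denotes the set of edges of $H$ with exactly one endpoint in $S$, and $\phi_H=\min_S |\partial_H(S)|/|S|$ over all $S\subseteq V(H)$ with $1\le|S|\le|V(H)|/2$. A graph $G$ is $f$-non-expanding if every subgraph $H$ of $G$ on $t>2$ vertices satisfies $\phi_H\le f(t)$.
   Formalization: The parameters $C$ and $\varepsilon$ range over the positive rationals. -}

module Defs where

open import Data.Nat using (ℕ; zero; suc; _+_; _*_; _^_; _≤_; _<_)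
open import Data.Bool using (Bool; true; false; _∧_; not; if_then_else_)
open import Data.Fin using (Fin) renaming (zero to fz; suc to fs)
open import Data.Fin.Properties using () renaming (_<?_ to _<ᶠ?_)
open import Data.Fin.Subset using (Subset; _∈_; _⊆_; ∣_∣)
open import Data.Vec using (lookup)
open import Data.Product using (Σ; _×_; ∃)
open import Relation.Nullary using (¬_; does)
open import Relation.Binary.PropositionalEquality using (_≡_)

record Graph (n : ℕ) : Set where
  field
    adj    : Fin n → Fin n → Bool
    sym    : ∀ i j → adj i j ≡ adj j i
    irrefl : ∀ i → adj i i ≡ false
open Graph public

Σᶠ : ∀ {n} → (Fin n → ℕ) → ℕ
Σᶠ {zero}  f = 0
Σᶠ {suc n} f = f fz + Σᶠ (λ i → f (fs i))

ind : Bool → ℕ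
ind b = if b then 1 else 0

SpanningSub : ∀ {n} → Graph n → Graph n → Set
SpanningSub G' G = ∀ i j → adj G' i j ≡ true → adj G i j ≡ true

removedEdges : ∀ {n} → Graph n → Graph n → ℕ
removedEdges G G' =
  Σᶠ λ i → Σᶠ λ j → ind (does (i <ᶠ? j) ∧ (adj G i j ∧ not (adj G' i j)))

data Reach {n} (G : Graph n) : Fin n → Fin n → Set where
  here : ∀ {v} → Reach G v v
  step : ∀ {u v w} → Reach G u v → adj G v w ≡ true → Reach G u w

-- Arbitrary (not necessarily induced) subgraphs H of G

record Subgraph {n} (G : Graph n) : Set where
  field
    verts    : Subset n
    edge     : Fin n → Fin n → Bool
    edge-sym : ∀ i j → edge i j ≡ edge j i
    edge-G   : ∀ i j → edge i j ≡ true → adj G i j ≡ true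
    edge-in  : ∀ i j → edge i j ≡ true → (i ∈ verts × j ∈ verts)
open Subgraph public

boundary : ∀ {n} {G : Graph n} → Subgraph G → Subset n → ℕ
boundary H S =
  Σᶠ λ i → Σᶠ λ j → ind (lookup S i ∧ (not (lookup S j) ∧ edge H i j))

-- Exact encodings of real comparisons involving log = log₂,
-- using rationals a/b given by naturals with b > 0.

-- a/b < log t   ⟺   2^a < t^b
LogGt : ℕ → ℕ → ℕ → Set
LogGt t a b = 2 ^ a < t ^ b

-- 2^(c/d) < p/q   ⟺   2^c · q^d < p^d
Pow2Lt : ℕ → ℕ → ℕ → ℕ → Set
Pow2Lt c d p q = 2 ^ c * q ^ d < p ^ d

-- c/d < log (log t)  ⟺  ∃ rational p/q with 2^(c/d) < p/q < log t
LogLogGt : ℕ → ℕ → ℕ → Set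
LogLogGt t c d = Σ ℕ λ p → Σ ℕ λ q → 0 < q × Pow2Lt c d p q × LogGt t p q

-- (cn/cd)·s < e · log t · (log log t)²   (strict real inequality, t > 2),
-- witnessed by nonnegative rationals a/b < log t and c/d < log log t.
ExpLt : (cn cd s e t : ℕ) → Set
ExpLt cn cd s e t =
  Σ ℕ λ a → Σ ℕ λ b → Σ ℕ λ c → Σ ℕ λ d →
    0 < b × 0 < d × LogGt t a b × LogLogGt t c d ×
    (cn * s * b * d ^ 2 < cd * e * a * c ^ 2)

-- |∂S|/|S| ≤ f(t) = C/(log t (log log t)²), with C = cn/cd, i.e.
-- |∂S| · log t · (log log t)² ≤ C·|S|, i.e. ¬ (C·|S| < |∂S| · log t · (log log t)²)
RatioLeF : (cn cd s e t : ℕ) → Set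
RatioLeF cn cd s e t = ¬ ExpLt cn cd s e t

-- φ_H ≤ f(|V(H)|)  (the minimum over admissible S is attained by some S)
PhiLeF : ∀ {n} {G : Graph n} → (cn cd : ℕ) → Subgraph G → Set
PhiLeF {n} cn cd H =
  Σ (Subset n) λ S → S ⊆ verts H × 1 ≤ ∣ S ∣ × 2 * ∣ S ∣ ≤ ∣ verts H ∣ ×
    RatioLeF cn cd (∣ S ∣) (boundary H S) (∣ verts H ∣)

-- G is f-non-expanding for f(x) = C/(log x (log log x)²), C = cn/cd
NonExpanding : ∀ {n} → (cn cd : ℕ) → Graph n → Set
NonExpanding cn cd G = (H : Subgraph G) → 2 < ∣ verts H ∣ → PhiLeF cn cd H

-- 2^(2^(X/Y)) < k  ⟺  ∃ rational p/q with 2^(X/Y) < p/q < log k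
DoubleExpLt : (X Y k : ℕ) → Set
DoubleExpLt X Y k = Σ ℕ λ p → Σ ℕ λ q → 0 < q × Pow2Lt X Y p q × LogGt k p q

-- k ≤ 2^(2^(2C/ε + 3)) with C = cn/cd, ε = en/ed;
-- 2C/ε + 3 = (2·cn·ed + 3·cd·en)/(cd·en)
SizeBound : (cn cd en ed k : ℕ) → Set
SizeBound cn cd en ed k = ¬ DoubleExpLt (2 * cn * ed + 3 * cd * en) (cd * en) k

module Submission where

-- Cut recursively along sparse cuts.  A part W with t = |W| > K = 2^(2^k₀) has, by
-- non-expansion, a cut S with 1 ≤ |S| ≤ t/2 and |∂S| ≤ C|S| / (log t (log log t)²); remove ∂S
-- and recurse on S and W ∖ S.  The vertices of S pay for ∂S, each at most C/(m (log m)²) where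
-- m = ⌈log t⌉ − 1, and m strictly drops every time a vertex lies on the small side.  Charging
-- C/(2^ℓ (ℓ−2)(ℓ−1)) to every m in the dyadic block [2^ℓ, 2^(ℓ+1)), ℓ ≥ k₀ = a + 2, a vertex
-- pays at most C Σ_ℓ 1/((ℓ−2)(ℓ−1)) = C/a in total, a telescoping sum; with a > 2C/ε this is
-- below ε/2.

open import Defs
open import Level using (0ℓ)
open import Data.Nat using (ℕ; zero; suc; pred; _+_; _*_; _^_; _∸_; _≤_; _<_; _≤′_; ≤′-refl; ≤′-step)
open import Data.Nat using (z≤n; s≤s; _≟_; _≤?_; NonZero; >-nonZero; _/_; _%_; ⌊_/2⌋; ⌈_/2⌉)
open import Data.Nat.Properties
open import Data.Nat.DivMod using (m≡m%n+[m/n]*n; m%n<n; m/n*n≤m)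
open import Data.Nat.Induction using (<-rec; <-wellFounded)
open import Data.Nat.Logarithm using (⌊log₂_⌋; ⌊log₂⌋-mono-≤; ⌊log₂[2^n]⌋≡n; ⌊log₂⌊n/2⌋⌋≡⌊log₂n⌋∸1)
open import Data.Nat.Tactic.RingSolver using (solve-∀)
open import Data.Bool using (Bool; true; false; _∧_; _∨_; not; if_then_else_)
open import Data.Bool.Properties using (∧-comm; ∧-zeroʳ; ∧-identityʳ; ∨-zeroʳ; ∨-identityʳ)
open import Data.Fin using (Fin) renaming (zero to fz; suc to fs)
open import Data.Fin.Properties using () renaming (_<?_ to _<ᶠ?_; <-asym to <ᶠ-asym)
open import Data.Fin.Subset using (Subset; _∈_; ∣_∣)
open import Data.Vec using ([]; _∷_; lookup; tabulate)
open import Data.Vec.Properties using (lookup∘tabulate; []=⇒lookup; lookup⇒[]=)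
open import Data.Product using (Σ; _×_; _,_; proj₁; proj₂)
open import Data.Sum using (_⊎_; inj₁; inj₂)
open import Data.Empty using (⊥; ⊥-elim)
open import Function using (_∘_; case_of_)
open import Induction.WellFounded using (module All)
open import Relation.Binary.Construct.On as On using ()
open import Relation.Nullary using (¬_; Dec; does; yes; no; contradiction)
open import Relation.Nullary.Decidable using (dec-true; dec-false)
open import Relation.Binary.PropositionalEquality
  using (_≡_; _≢_; refl; cong; cong₂; trans; subst; subst₂; module ≡-Reasoning)
  renaming (sym to ≡-sym)
open import Algebra.Properties.CommutativeMonoid.Sum +-0-commutativeMonoid
  using (sum; sum-cong-≗; sum-replicate-zero; ∑-distrib-+; ∑-comm)

Σᶠ≡sum : ∀ {n} (f : Fin n → ℕ) → Σᶠ f ≡ sum f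
Σᶠ≡sum {zero}  f = refl
Σᶠ≡sum {suc n} f = cong (f fz +_) (Σᶠ≡sum (λ i → f (fs i)))

Σᶠ-cong : ∀ {n} {f g : Fin n → ℕ} → (∀ i → f i ≡ g i) → Σᶠ f ≡ Σᶠ g
Σᶠ-cong {f = f} {g} f≗g = trans (Σᶠ≡sum f) (trans (sum-cong-≗ f≗g) (≡-sym (Σᶠ≡sum g)))

Σᶠ-mono-≤ : ∀ {n} {f g : Fin n → ℕ} → (∀ i → f i ≤ g i) → Σᶠ f ≤ Σᶠ g
Σᶠ-mono-≤ {zero}  f≤g = z≤n
Σᶠ-mono-≤ {suc n} f≤g = +-mono-≤ (f≤g fz) (Σᶠ-mono-≤ (λ i → f≤g (fs i)))

Σᶠ-distrib-+ : ∀ {n} (f g : Fin n → ℕ) → Σᶠ (λ i → f i + g i) ≡ Σᶠ f + Σᶠ g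
Σᶠ-distrib-+ f g = begin
  Σᶠ (λ i → f i + g i)   ≡⟨ Σᶠ≡sum (λ i → f i + g i) ⟩
  sum (λ i → f i + g i)  ≡⟨ ∑-distrib-+ f g ⟩
  sum f + sum g          ≡˘⟨ cong₂ _+_ (Σᶠ≡sum f) (Σᶠ≡sum g) ⟩
  Σᶠ f + Σᶠ g            ∎
  where open ≡-Reasoning

Σᶠ-zero : ∀ n → Σᶠ {n} (λ _ → 0) ≡ 0
Σᶠ-zero n = trans (Σᶠ≡sum {n} (λ _ → 0)) (sum-replicate-zero n)

Σ² : ∀ {n} → (Fin n → Fin n → ℕ) → ℕ
Σ² f = Σᶠ λ i → Σᶠ λ j → f i j

Σ²-zero : ∀ n → Σ² {n} (λ _ _ → 0) ≡ 0
Σ²-zero n = trans (Σᶠ-cong {n} (λ _ → Σᶠ-zero n)) (Σᶠ-zero n)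

Σ²-mono-≤ : ∀ {n} {f g : Fin n → Fin n → ℕ} → (∀ i j → f i j ≤ g i j) →
  Σ² f ≤ Σ² g
Σ²-mono-≤ f≤g = Σᶠ-mono-≤ (λ i → Σᶠ-mono-≤ (f≤g i))

Σ²-distrib-+ : ∀ {n} (f g : Fin n → Fin n → ℕ) →
  Σ² (λ i j → f i j + g i j) ≡ Σ² f + Σ² g
Σ²-distrib-+ f g = trans (Σᶠ-cong (λ i → Σᶠ-distrib-+ (f i) (g i)))
                         (Σᶠ-distrib-+ (λ i → Σᶠ (f i)) (λ i → Σᶠ (g i)))

Σ²-transpose : ∀ {n} (f : Fin n → Fin n → ℕ) → Σ² f ≡ Σ² (λ i j → f j i)
Σ²-transpose f = begin
  Σ² f                           ≡⟨ Σᶠ≡sum (λ i → Σᶠ (f i)) ⟩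
  sum (λ i → Σᶠ (f i))           ≡⟨ sum-cong-≗ (λ i → Σᶠ≡sum (f i)) ⟩
  sum (λ i → sum (f i))          ≡⟨ ∑-comm f ⟩
  sum (λ j → sum (λ i → f i j))  ≡˘⟨ sum-cong-≗ (λ j → Σᶠ≡sum (λ i → f i j)) ⟩
  sum (λ j → Σᶠ (λ i → f i j))   ≡˘⟨ Σᶠ≡sum (λ j → Σᶠ (λ i → f i j)) ⟩
  Σ² (λ j i → f i j)             ∎
  where open ≡-Reasoning

∧-true : ∀ {x y} → x ∧ y ≡ true → x ≡ true × y ≡ true
∧-true {true} y≡true = refl , y≡true

∨-true : ∀ {x y} → x ∨ y ≡ true → x ≡ true ⊎ y ≡ true
∨-true {true}  _      = inj₁ refl
∨-true {false} y≡true = inj₂ y≡true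

does⇒ : ∀ {p} {P : Set p} (P? : Dec P) → does P? ≡ true → P
does⇒ (yes p) _ = p

ind-mono : ∀ {x y} → (x ≡ true → y ≡ true) → ind x ≤ ind y
ind-mono {false} _   = z≤n
ind-mono {true}  x⇒y rewrite x⇒y refl = ≤-refl

count : ∀ {n} → (Fin n → Bool) → ℕ
count P = Σᶠ λ i → ind (P i)

∣p∣≡count : ∀ {n} (p : Subset n) → ∣ p ∣ ≡ count (lookup p)
∣p∣≡count []          = refl
∣p∣≡count (true ∷ p)  = cong suc (∣p∣≡count p)
∣p∣≡count (false ∷ p) = ∣p∣≡count p

∣tabulate∣≡count : ∀ {n} (W : Fin n → Bool) → ∣ tabulate W ∣ ≡ count W
∣tabulate∣≡count W =
  trans (∣p∣≡count (tabulate W)) (Σᶠ-cong (λ i → cong ind (lookup∘tabulate W i)))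

count-all : ∀ n → count {n} (λ _ → true) ≡ n
count-all zero    = refl
count-all (suc n) = cong suc (count-all n)

count-mono-≤ : ∀ {n} {P Q : Fin n → Bool} → (∀ i → P i ≡ true → Q i ≡ true) →
  count P ≤ count Q
count-mono-≤ P⇒Q = Σᶠ-mono-≤ (λ i → ind-mono (P⇒Q i))

count≤n : ∀ {n} (W : Fin n → Bool) → count W ≤ n
count≤n {n} W = subst (count W ≤_) (count-all n) (count-mono-≤ {n} (λ _ _ → refl))

_─_ : ∀ {n} → (Fin n → Bool) → (Fin n → Bool) → Fin n → Bool
(W ─ S) i = W i ∧ not (S i)

─-⊆ : ∀ {n} {W S : Fin n → Bool} i → (W ─ S) i ≡ true → W i ≡ true
─-⊆ i = proj₁ ∘ ∧-true

─-∈ : ∀ {n} {W S : Fin n → Bool} {i} → W i ≡ true → S i ≡ false → (W ─ S) i ≡ true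
─-∈ Wi Si rewrite Wi | Si = refl

─-disjoint : ∀ {n} {W S : Fin n → Bool} i → S i ≡ true → (W ─ S) i ≡ true → ⊥
─-disjoint {W = W} i Si WSi rewrite Si | ∧-zeroʳ (W i) = case WSi of λ ()

count-split : ∀ {n} {W S : Fin n → Bool} → (∀ i → S i ≡ true → W i ≡ true) →
  count W ≡ count S + count (W ─ S)
count-split {W = W} {S} S⊆W =
  trans (Σᶠ-cong split) (Σᶠ-distrib-+ (λ i → ind (S i)) (λ i → ind ((W ─ S) i)))
  where
  split : ∀ i → ind (W i) ≡ ind (S i) + ind ((W ─ S) i)
  split i with S i | S⊆W i
  ... | true  | S⊆W rewrite S⊆W refl = refl
  ... | false | _   = cong ind (≡-sym (∧-identityʳ (W i)))

induced : ∀ {n} → Graph n → (Fin n → Bool) → Graph n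
induced G W = record
  { adj    = λ i j → (W i ∧ W j) ∧ adj G i j
  ; sym    = λ i j → cong₂ _∧_ (∧-comm (W i) (W j)) (sym G i j)
  ; irrefl = λ i → trans (cong ((W i ∧ W i) ∧_) (irrefl G i)) (∧-zeroʳ (W i ∧ W i))
  }

_∪ᴳ_ : ∀ {n} → Graph n → Graph n → Graph n
G₁ ∪ᴳ G₂ = record
  { adj    = λ i j → adj G₁ i j ∨ adj G₂ i j
  ; sym    = λ i j → cong₂ _∨_ (sym G₁ i j) (sym G₂ i j)
  ; irrefl = λ i → cong₂ _∨_ (irrefl G₁ i) (irrefl G₂ i)
  }

EdgesWithin : ∀ {n} → Graph n → (Fin n → Bool) → Set
EdgesWithin G W = ∀ i j → adj G i j ≡ true → W i ≡ true × W j ≡ true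

induced-spanning : ∀ {n} (G : Graph n) W → SpanningSub (induced G W) G
induced-spanning G W i j e = proj₂ (∧-true e)

induced-within : ∀ {n} (G : Graph n) W → EdgesWithin (induced G W) W
induced-within G W i j e = ∧-true (proj₁ (∧-true e))

inducedSubgraph : ∀ {n} (G : Graph n) → (Fin n → Bool) → Subgraph G
inducedSubgraph G W = record
  { verts    = tabulate W
  ; edge     = adj (induced G W)
  ; edge-sym = sym (induced G W)
  ; edge-G   = induced-spanning G W
  ; edge-in  = λ i j e → let Wi , Wj = induced-within G W i j e in ∈-tabulate Wi , ∈-tabulate Wj
  }
  where
  ∈-tabulate : ∀ {i} → W i ≡ true → i ∈ tabulate W
  ∈-tabulate {i} Wi = lookup⇒[]= i (tabulate W) (trans (lookup∘tabulate W i) Wi)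

∪-spanning : ∀ {n} {G : Graph n} G₁ G₂ → SpanningSub G₁ G → SpanningSub G₂ G →
  SpanningSub (G₁ ∪ᴳ G₂) G
∪-spanning G₁ G₂ sp₁ sp₂ i j e with ∨-true e
... | inj₁ e₁ = sp₁ i j e₁
... | inj₂ e₂ = sp₂ i j e₂

∪-within : ∀ {n} (G₁ G₂ : Graph n) {W : Fin n → Bool} →
  EdgesWithin G₁ W → EdgesWithin G₂ W → EdgesWithin (G₁ ∪ᴳ G₂) W
∪-within G₁ G₂ within₁ within₂ i j e with ∨-true e
... | inj₁ e₁ = within₁ i j e₁
... | inj₂ e₂ = within₂ i j e₂

EdgesWithin-⊆ : ∀ {n} (G : Graph n) {A B : Fin n → Bool} →
  (∀ i → A i ≡ true → B i ≡ true) → EdgesWithin G A → EdgesWithin G B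
EdgesWithin-⊆ G A⊆B within i j e = let Ai , Aj = within i j e in A⊆B i Ai , A⊆B j Aj

module _ {n} {A B : Fin n → Bool} (disjoint : ∀ i → A i ≡ true → B i ≡ true → ⊥) where

  ∪-edges-fromˡ : (G₁ G₂ : Graph n) → EdgesWithin G₂ B →
    ∀ i j → A i ≡ true → adj (G₁ ∪ᴳ G₂) i j ≡ true → adj G₁ i j ≡ true
  ∪-edges-fromˡ G₁ G₂ within₂ i j Ai e with ∨-true e
  ... | inj₁ e₁ = e₁
  ... | inj₂ e₂ = ⊥-elim (disjoint i Ai (proj₁ (within₂ i j e₂)))

  ∪-edges-fromʳ : (G₁ G₂ : Graph n) → EdgesWithin G₁ B →
    ∀ i j → A i ≡ true → adj (G₁ ∪ᴳ G₂) i j ≡ true → adj G₂ i j ≡ true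
  ∪-edges-fromʳ G₁ G₂ within₁ i j Ai e with ∨-true e
  ... | inj₁ e₁ = ⊥-elim (disjoint i Ai (proj₁ (within₁ i j e₁)))
  ... | inj₂ e₂ = e₂

reach-confined : ∀ {n} {H G₁ : Graph n} {A : Fin n → Bool} →
  (∀ i j → A i ≡ true → adj H i j ≡ true → adj G₁ i j ≡ true) → EdgesWithin G₁ A →
  ∀ {v u} → A v ≡ true → Reach H v u → Reach G₁ v u × A u ≡ true
reach-confined H⇒G₁ within Av here = here , Av
reach-confined H⇒G₁ within Av (step p e) with reach-confined H⇒G₁ within Av p
... | p₁ , Aw = step p₁ e₁ , proj₂ (within _ _ e₁)
  where e₁ = H⇒G₁ _ _ Aw e

component-size : ∀ {n} {G : Graph n} {W : Fin n → Bool} → EdgesWithin G W →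
  ∀ {v} → W v ≡ true → (U : Subset n) → (∀ u → u ∈ U → Reach G v u) → ∣ U ∣ ≤ count W
component-size {G = G} {W} within {v} Wv U reach = begin
  ∣ U ∣             ≡⟨ ∣p∣≡count U ⟩
  count (lookup U)  ≤⟨ count-mono-≤ (λ u Uu → proj₂ (stays-in-W (reach u (lookup⇒[]= u U Uu)))) ⟩
  count W           ∎
  where
  open ≤-Reasoning
  stays-in-W : ∀ {u} → Reach G v u → Reach G v u × W u ≡ true
  stays-in-W = reach-confined {H = G} {G₁ = G} (λ _ _ _ e → e) within Wv

-- missing G (λ _ → true) G' is removedEdges G G' by definition.
missing : ∀ {n} → Graph n → (Fin n → Bool) → Graph n → ℕ
missing G W G' =
  Σ² λ i j → ind (does (i <ᶠ? j) ∧ ((W i ∧ W j) ∧ (adj G i j ∧ not (adj G' i j))))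

ind-missing-induced : ∀ l w g → ind (l ∧ (w ∧ (g ∧ not (w ∧ g)))) ≡ 0
ind-missing-induced false _     _     = refl
ind-missing-induced true  false _     = refl
ind-missing-induced true  true  false = refl
ind-missing-induced true  true  true  = refl

missing-induced : ∀ {n} (G : Graph n) W → missing G W (induced G W) ≡ 0
missing-induced {n} G W = trans
  (Σᶠ-cong {n} λ i → Σᶠ-cong {n} λ j →
     ind-missing-induced (does (i <ᶠ? j)) (W i ∧ W j) (adj G i j))
  (Σ²-zero n)

-- An edge inside W that is missing from G₁ ∪ G₂ lies inside S and is missing from G₁,
-- lies inside W ∖ S and is missing from G₂, or crosses the cut in one of two directions.
ind-missing-∪ : ∀ l wi wj si sj g h₁ h₂ →
  ind (l ∧ ((wi ∧ wj) ∧ (g ∧ not (h₁ ∨ h₂)))) ≤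
    ind (l ∧ ((si ∧ sj) ∧ (g ∧ not h₁)))
  + ind (l ∧ (((wi ∧ not si) ∧ (wj ∧ not sj)) ∧ (g ∧ not h₂)))
  + (ind (l ∧ (si ∧ (not sj ∧ ((wi ∧ wj) ∧ g))))
     + ind (l ∧ (sj ∧ (not si ∧ ((wj ∧ wi) ∧ g)))))
ind-missing-∪ false _     _     _     _     _     _     _     = z≤n
ind-missing-∪ true  false _     _     _     _     _     _     = z≤n
ind-missing-∪ true  true  false _     _     _     _     _     = z≤n
ind-missing-∪ true  true  true  _     _     false _     _     = z≤n
ind-missing-∪ true  true  true  _     _     true  true  _     = z≤n
ind-missing-∪ true  true  true  _     _     true  false true  = z≤n
ind-missing-∪ true  true  true  true  true  true  false false = ≤-refl
ind-missing-∪ true  true  true  true  false true  false false = s≤s z≤n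
ind-missing-∪ true  true  true  false true  true  false false = s≤s z≤n
ind-missing-∪ true  true  true  false false true  false false = s≤s z≤n

ind-exclusive : ∀ {l₁ l₂} → (l₁ ≡ true → l₂ ≡ true → ⊥) → ∀ x →
  ind (l₁ ∧ x) + ind (l₂ ∧ x) ≤ ind x
ind-exclusive {true}  {true}  excl x = ⊥-elim (excl refl refl)
ind-exclusive {true}  {false} excl x = ≤-reflexive (+-identityʳ (ind x))
ind-exclusive {false} {l₂}    excl x = ind-mono (λ e → proj₂ (∧-true {l₂} e))

ind-<-exclusive : ∀ {n} (i j : Fin n) x →
  ind (does (i <ᶠ? j) ∧ x) + ind (does (j <ᶠ? i) ∧ x) ≤ ind x
ind-<-exclusive i j =
  ind-exclusive λ i<j j<i → <ᶠ-asym (does⇒ (i <ᶠ? j) i<j) (does⇒ (j <ᶠ? i) j<i)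

module _ {n} (G : Graph n) (W : Fin n → Bool) (S : Subset n) where

  private
    crossing : Fin n → Fin n → Bool
    crossing i j = lookup S i ∧ (not (lookup S j) ∧ edge (inducedSubgraph G W) i j)

    crossing< crossing> : Fin n → Fin n → ℕ
    crossing< i j = ind (does (i <ᶠ? j) ∧ crossing i j)
    crossing> i j = ind (does (i <ᶠ? j) ∧ crossing j i)

  crossing-bound : Σ² crossing< + Σ² crossing> ≤ boundary (inducedSubgraph G W) S
  crossing-bound = begin
    Σ² crossing< + Σ² crossing>
      ≡⟨ cong (Σ² crossing< +_) (Σ²-transpose crossing>) ⟩
    Σ² crossing< + Σ² (λ i j → ind (does (j <ᶠ? i) ∧ crossing i j))
      ≡˘⟨ Σ²-distrib-+ crossing< (λ i j → ind (does (j <ᶠ? i) ∧ crossing i j)) ⟩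
    Σ² (λ i j → crossing< i j + ind (does (j <ᶠ? i) ∧ crossing i j))
      ≤⟨ Σ²-mono-≤ (λ i j → ind-<-exclusive i j (crossing i j)) ⟩
    boundary (inducedSubgraph G W) S
      ∎
    where open ≤-Reasoning

  missing-∪ : ∀ G₁ G₂ →
    missing G W (G₁ ∪ᴳ G₂) ≤ missing G (lookup S) G₁ + missing G (W ─ lookup S) G₂
                              + boundary (inducedSubgraph G W) S
  missing-∪ G₁ G₂ = begin
    missing G W (G₁ ∪ᴳ G₂)
      ≤⟨ Σ²-mono-≤ pointwise ⟩
    Σ² (λ i j → m₁ i j + m₂ i j + (crossing< i j + crossing> i j))
      ≡⟨ Σ²-distrib-+ (λ i j → m₁ i j + m₂ i j) (λ i j → crossing< i j + crossing> i j) ⟩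
    Σ² (λ i j → m₁ i j + m₂ i j) + Σ² (λ i j → crossing< i j + crossing> i j)
      ≡⟨ cong₂ _+_ (Σ²-distrib-+ m₁ m₂) (Σ²-distrib-+ crossing< crossing>) ⟩
    Σ² m₁ + Σ² m₂ + (Σ² crossing< + Σ² crossing>)
      ≤⟨ +-monoʳ-≤ (Σ² m₁ + Σ² m₂) crossing-bound ⟩
    missing G (lookup S) G₁ + missing G (W ─ lookup S) G₂ + boundary (inducedSubgraph G W) S
      ∎
    where
    open ≤-Reasoning
    S′ = lookup S
    m₁ m₂ : Fin n → Fin n → ℕ
    m₁ i j = ind (does (i <ᶠ? j) ∧ ((S′ i ∧ S′ j) ∧ (adj G i j ∧ not (adj G₁ i j))))
    m₂ i j = ind (does (i <ᶠ? j) ∧ (((W ─ S′) i ∧ (W ─ S′) j) ∧ (adj G i j ∧ not (adj G₂ i j))))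
    pointwise : ∀ i j →
      ind (does (i <ᶠ? j) ∧ ((W i ∧ W j) ∧ (adj G i j ∧ not (adj (G₁ ∪ᴳ G₂) i j))))
        ≤ m₁ i j + m₂ i j + (crossing< i j + crossing> i j)
    pointwise i j rewrite sym G j i =
      ind-missing-∪ (does (i <ᶠ? j)) (W i) (W j) (S′ i) (S′ j) (adj G i j) (adj G₁ i j) (adj G₂ i j)

-- The recursive decomposition

cost-step : ∀ {k s b c₁ c₂ ∂ c Z t φs φb φt} →
  c ≤ c₁ + c₂ + ∂ → c₁ * Z ≤ k * s * φs → c₂ * Z ≤ k * b * φb →
  ∂ * Z + k * s * φs ≤ k * s * φt → φb ≤ φt → t ≡ s + b → c * Z ≤ k * t * φt
cost-step {k} {s} {b} {c₁} {c₂} {∂} {c} {Z} {_} {φs} {φb} {φt} c≤ c₁≤ c₂≤ charged φb≤φt refl = begin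
  c * Z                            ≤⟨ *-monoˡ-≤ Z c≤ ⟩
  (c₁ + c₂ + ∂) * Z                ≡⟨ rearrange c₁ c₂ ∂ Z ⟩
  ∂ * Z + c₁ * Z + c₂ * Z          ≤⟨ +-mono-≤ (+-monoʳ-≤ (∂ * Z) c₁≤) c₂≤ ⟩
  ∂ * Z + k * s * φs + k * b * φb  ≤⟨ +-mono-≤ charged (*-monoʳ-≤ (k * b) φb≤φt) ⟩
  k * s * φt + k * b * φt          ≡⟨ collect k s b φt ⟩
  k * (s + b) * φt                 ∎
  where
  open ≤-Reasoning
  rearrange : ∀ x y z w → (x + y + z) * w ≡ z * w + x * w + y * w
  rearrange = solve-∀
  collect : ∀ k s b φ → k * s * φ + k * b * φ ≡ k * (s + b) * φ
  collect = solve-∀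

-- Costs are counted in units of 1/Z; charge says that a sparse cut of a part of size t
-- pays for its boundary from the increase of the potential Φ on its small side.
module Decompose {n} (G : Graph n) (cn cd : ℕ) (non-expanding : NonExpanding cn cd G)
  (K Z : ℕ) (2<K : 2 < K) (Φ : ℕ → ℕ) (Φ-mono : ∀ {s t} → s ≤ t → Φ s ≤ Φ t)
  (charge : ∀ {s e t} → t ≤ n → K < t → 2 * s ≤ t → RatioLeF cn cd s e t →
              e * Z + cn * s * Φ s ≤ cn * s * Φ t)
  where

  record Decomposition (W : Fin n → Bool) : Set where
    field
      graph    : Graph n
      spanning : SpanningSub graph G
      within   : EdgesWithin graph W
      cost     : missing G W graph * Z ≤ cn * count W * Φ (count W)
      small    : ∀ {v} → W v ≡ true → (U : Subset n) →
                 (∀ u → u ∈ U → Reach graph v u) → ∣ U ∣ ≤ K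

  keep : ∀ W → count W ≤ K → Decomposition W
  keep W t≤K = record
    { graph    = induced G W
    ; spanning = induced-spanning G W
    ; within   = induced-within G W
    ; cost     = subst (λ c → c * Z ≤ cn * count W * Φ (count W))
                       (≡-sym (missing-induced G W)) z≤n
    ; small    = λ Wv U reach → ≤-trans (component-size (induced-within G W) Wv U reach) t≤K
    }

  split : ∀ W → K < count W → (∀ {W′} → count W′ < count W → Decomposition W′) →
    PhiLeF cn cd (inducedSubgraph G W) → Decomposition W
  split W K<t rec (Sv , Sv⊆W , 1≤∣Sv∣ , 2∣Sv∣≤t , sparse) = record
    { graph    = G′
    ; spanning = ∪-spanning {G = G} D₁.graph D₂.graph D₁.spanning D₂.spanning
    ; within   = ∪-within D₁.graph D₂.graph (EdgesWithin-⊆ D₁.graph S⊆W D₁.within)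
                                            (EdgesWithin-⊆ D₂.graph (─-⊆ {W = W} {S}) D₂.within)
    ; cost     = cost-step {cn} {count S} {count B} {missing G S D₁.graph} {missing G B D₂.graph}
                   (missing-∪ G W Sv D₁.graph D₂.graph) D₁.cost D₂.cost charged
                   (Φ-mono (<⇒≤ B<W)) (count-split S⊆W)
    ; small    = small
    }
    where
    S B : Fin n → Bool
    S = lookup Sv
    B = W ─ S

    S⊆W : ∀ i → S i ≡ true → W i ≡ true
    S⊆W i Si = trans (≡-sym (lookup∘tabulate W i)) ([]=⇒lookup (Sv⊆W (lookup⇒[]= i Sv Si)))

    1≤s : 1 ≤ count S
    1≤s = subst (1 ≤_) (∣p∣≡count Sv) 1≤∣Sv∣

    2s≤t : 2 * count S ≤ count W
    2s≤t = subst₂ (λ s t → 2 * s ≤ t) (∣p∣≡count Sv) (∣tabulate∣≡count W) 2∣Sv∣≤t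

    S<W : count S < count W
    S<W = <-≤-trans (m<m+n (count S) (≤-trans 1≤s (m≤m+n (count S) 0))) 2s≤t

    B<W : count B < count W
    B<W = subst (count B <_) (≡-sym (trans (count-split S⊆W) (+-comm (count S) (count B))))
                (m<m+n (count B) 1≤s)

    module D₁ = Decomposition (rec S<W)
    module D₂ = Decomposition (rec B<W)
    G′ = D₁.graph ∪ᴳ D₂.graph

    charged : boundary (inducedSubgraph G W) Sv * Z + cn * count S * Φ (count S)
              ≤ cn * count S * Φ (count W)
    charged = charge (count≤n W) K<t 2s≤t
      (subst₂ (λ s t → RatioLeF cn cd s (boundary (inducedSubgraph G W) Sv) t)
              (∣p∣≡count Sv) (∣tabulate∣≡count W) sparse)

    S∩B=∅ : ∀ i → S i ≡ true → B i ≡ true → ⊥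
    S∩B=∅ = ─-disjoint {W = W} {S}

    small : ∀ {v} → W v ≡ true → (U : Subset n) → (∀ u → u ∈ U → Reach G′ v u) → ∣ U ∣ ≤ K
    small {v} Wv U reach with S v in Sv≡
    ... | true  = D₁.small Sv≡ U λ u u∈U → proj₁ (reach-confined
      (∪-edges-fromˡ S∩B=∅ D₁.graph D₂.graph D₂.within) D₁.within Sv≡ (reach u u∈U))
    ... | false = D₂.small Bv U λ u u∈U → proj₁ (reach-confined
      (∪-edges-fromʳ (λ i Bi Si → S∩B=∅ i Si Bi) D₁.graph D₂.graph D₁.within) D₂.within Bv
      (reach u u∈U))
      where Bv = ─-∈ {W = W} {S} Wv Sv≡

  decompose : ∀ W → Decomposition W
  decompose = All.wfRec (On.wellFounded count <-wellFounded) 0ℓ Decomposition extend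
    where
    extend : ∀ W → (∀ {W′} → count W′ < count W → Decomposition W′) → Decomposition W
    extend W rec with count W ≤? K
    ... | yes t≤K = keep W t≤K
    ... | no  t≰K = split W K<t rec (non-expanding (inducedSubgraph G W) 2<t)
      where
      K<t = ≰⇒> t≰K
      2<t = subst (2 <_) (≡-sym (∣tabulate∣≡count W)) (<-trans 2<K K<t)

  decomposition : Σ (Graph n) λ G′ → SpanningSub G′ G × (removedEdges G G′ * Z ≤ cn * n * Φ n) ×
    ((v : Fin n) (U : Subset n) → (∀ u → u ∈ U → Reach G′ v u) → ∣ U ∣ ≤ K)
  decomposition = D.graph , D.spanning
    , subst (λ t → removedEdges G D.graph * Z ≤ cn * t * Φ t) (count-all n) D.cost
    , λ v U → D.small refl U
    where module D = Decomposition (decompose (λ _ → true))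

-- Logarithms

^-cancelʳ-< : ∀ m .{{_ : NonZero m}} {a b} → m ^ a < m ^ b → a < b
^-cancelʳ-< m m^a<m^b = ≰⇒> λ b≤a → <⇒≱ m^a<m^b (^-monoʳ-≤ m b≤a)

^-cancelˡ-< : ∀ k {x y} → x ^ k < y ^ k → x < y
^-cancelˡ-< k x^k<y^k = ≰⇒> λ y≤x → <⇒≱ x^k<y^k (^-monoˡ-≤ k y≤x)

^-distribʳ-* : ∀ x y k → (x * y) ^ k ≡ x ^ k * y ^ k
^-distribʳ-* x y zero    = refl
^-distribʳ-* x y (suc k) =
  trans (cong (x * y *_) (^-distribʳ-* x y k)) (shuffle x y (x ^ k) (y ^ k))
  where
  shuffle : ∀ x y p q → x * y * (p * q) ≡ x * p * (y * q)
  shuffle = solve-∀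

2*⌊n/2⌋≤n : ∀ n → 2 * ⌊ n /2⌋ ≤ n
2*⌊n/2⌋≤n n = begin
  2 * ⌊ n /2⌋        ≡⟨ cong (⌊ n /2⌋ +_) (+-identityʳ ⌊ n /2⌋) ⟩
  ⌊ n /2⌋ + ⌊ n /2⌋  ≤⟨ +-monoʳ-≤ ⌊ n /2⌋ (⌊n/2⌋≤⌈n/2⌉ n) ⟩
  ⌊ n /2⌋ + ⌈ n /2⌉  ≡⟨ ⌊n/2⌋+⌈n/2⌉≡n n ⟩
  n                  ∎
  where open ≤-Reasoning

⌊log₂⌋-greatest : ∀ {m x} → 2 ^ m ≤ x → m ≤ ⌊log₂ x ⌋
⌊log₂⌋-greatest {m} 2^m≤x = subst (_≤ _) (⌊log₂[2^n]⌋≡n m) (⌊log₂⌋-mono-≤ 2^m≤x)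

<2^suc⌊log₂⌋ : ∀ x → x < 2 ^ suc ⌊log₂ x ⌋
<2^suc⌊log₂⌋ x = ≰⇒> λ 2^suc≤x → 1+n≰n (⌊log₂⌋-greatest 2^suc≤x)

2^⌊log₂⌋≤ : ∀ {x} → 1 ≤ x → 2 ^ ⌊log₂ x ⌋ ≤ x
2^⌊log₂⌋≤ {x} = <-rec (λ x → 1 ≤ x → 2 ^ ⌊log₂ x ⌋ ≤ x) halve x
  where
  halve : ∀ x → (∀ {y} → y < x → 1 ≤ y → 2 ^ ⌊log₂ y ⌋ ≤ y) → 1 ≤ x → 2 ^ ⌊log₂ x ⌋ ≤ x
  halve (suc zero)      _  _ = ≤-refl
  halve x@(suc (suc k)) ih _ = begin
    2 ^ ⌊log₂ x ⌋            ≡⟨ cong (2 ^_) log-halves ⟩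
    2 * 2 ^ ⌊log₂ ⌊ x /2⌋ ⌋  ≤⟨ *-monoʳ-≤ 2 (ih {⌊ x /2⌋} (⌊n/2⌋<n (suc k)) (s≤s z≤n)) ⟩
    2 * ⌊ x /2⌋              ≤⟨ 2*⌊n/2⌋≤n x ⟩
    x                        ∎
    where
    open ≤-Reasoning
    log-halves : ⌊log₂ x ⌋ ≡ suc ⌊log₂ ⌊ x /2⌋ ⌋
    log-halves = trans (≡-sym (m+[n∸m]≡n (⌊log₂⌋-greatest {1} {x} (s≤s (s≤s z≤n)))))
                       (cong suc (≡-sym (⌊log₂⌊n/2⌋⌋≡⌊log₂n⌋∸1 x)))

⌊log₂⌋-unique : ∀ {ℓ m} → 2 ^ ℓ ≤ m → m < 2 ^ suc ℓ → ⌊log₂ m ⌋ ≡ ℓ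
⌊log₂⌋-unique {ℓ} 2^ℓ≤m m<2^1+ℓ = ≤-antisym
  (≤-pred (^-cancelʳ-< 2 (≤-<-trans (2^⌊log₂⌋≤ (≤-trans (m^n>0 2 ℓ) 2^ℓ≤m)) m<2^1+ℓ)))
  (⌊log₂⌋-greatest 2^ℓ≤m)

-- logBelow t is the largest m with 2^m < t (for t ≥ 2), that is ⌈log₂ t⌉ − 1.
logBelow : ℕ → ℕ
logBelow t = ⌊log₂ pred t ⌋

2^logBelow< : ∀ {t} → 2 ≤ t → 2 ^ logBelow t < t
2^logBelow< {suc t} (s≤s 1≤t) = s≤s (2^⌊log₂⌋≤ 1≤t)

logBelow-greatest : ∀ {m t} → 2 ^ m < t → m ≤ logBelow t
logBelow-greatest {t = suc t} (s≤s 2^m≤t) = ⌊log₂⌋-greatest 2^m≤t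

logBelow-mono-≤ : ∀ {s t} → s ≤ t → logBelow s ≤ logBelow t
logBelow-mono-≤ s≤t = ⌊log₂⌋-mono-≤ (pred-mono-≤ s≤t)

logBelow-half : ∀ {s t} → 2 * s ≤ t → 1 ≤ logBelow t → logBelow s < logBelow t
logBelow-half {zero}        _    1≤ = 1≤
logBelow-half {suc zero}    _    1≤ = 1≤
logBelow-half {suc (suc s)} 2s≤t _  = logBelow-greatest
  (<-≤-trans (*-monoʳ-< 2 (2^logBelow< {suc (suc s)} (s≤s (s≤s z≤n)))) 2s≤t)

-- Telescoping products

prodExcept : (ℕ → ℕ) → ℕ → (ℕ → Bool) → ℕ
prodExcept x zero    s = 1
prodExcept x (suc T) s = prodExcept x T s * (if s T then 1 else x T)

prodExcept-cong : ∀ x T {s s′} → (∀ i → i < T → s i ≡ s′ i) →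
  prodExcept x T s ≡ prodExcept x T s′
prodExcept-cong x zero    s≗s′ = refl
prodExcept-cong x (suc T) s≗s′ = cong₂ (λ p b → p * (if b then 1 else x T))
  (prodExcept-cong x T (λ i i<T → s≗s′ i (m≤n⇒m≤1+n i<T))) (s≗s′ T ≤-refl)

prodExcept-pos : ∀ {x} → (∀ i → 0 < x i) → ∀ T s → 0 < prodExcept x T s
prodExcept-pos x>0 zero    s = s≤s z≤n
prodExcept-pos x>0 (suc T) s = *-mono-≤ (prodExcept-pos x>0 T s) last>0
  where
  last>0 : 0 < (if s T then 1 else _)
  last>0 with s T
  ... | true  = s≤s z≤n
  ... | false = x>0 T

prodExcept-restore : ∀ x T {y s s′} → y < T → s y ≡ true → s′ y ≡ false →
  (∀ i → i ≢ y → s i ≡ s′ i) → prodExcept x T s * x y ≡ prodExcept x T s′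
prodExcept-restore x (suc T) {y} {s} {s′} y<1+T sy s′y s≗s′ with y ≟ T
... | yes refl rewrite sy | s′y =
  cong (_* x y) (trans (*-identityʳ _) (prodExcept-cong x y (λ i i<y → s≗s′ i (<⇒≢ i<y))))
... | no y≢T rewrite ≡-sym (s≗s′ T (y≢T ∘ ≡-sym)) = begin
  prodExcept x T s * f * x y  ≡⟨ swap (prodExcept x T s) f (x y) ⟩
  prodExcept x T s * x y * f  ≡⟨ cong (_* f) (prodExcept-restore x T y<T sy s′y s≗s′) ⟩
  prodExcept x T s′ * f       ∎
  where
  open ≡-Reasoning
  f = if s T then 1 else x T
  y<T = ≤∧≢⇒< (≤-pred y<1+T) y≢T
  swap : ∀ p q r → p * q * r ≡ p * r * q
  swap = solve-∀

except₁ except₂ : ℕ → ℕ → Bool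
except₁ r i = does (i ≟ r)
except₂ r i = does (i ≟ r) ∨ does (i ≟ suc r)

-- F/x r = F / x r and F/xx r = F / (x r · x (r + 1)); since x (r + 1) = x r + 1,
-- F/x-telescope is 1/(a + r) = 1/(a + r + 1) + 1/((a + r)(a + r + 1)).
module Telescope (a T : ℕ) where

  x : ℕ → ℕ
  x i = a + i

  F : ℕ
  F = prodExcept x T (λ _ → false)

  F-pos : 0 < a → 0 < F
  F-pos 0<a = prodExcept-pos (λ i → ≤-trans 0<a (m≤m+n a i)) T (λ _ → false)

  F/x F/xx : ℕ → ℕ
  F/x  r = prodExcept x T (except₁ r)
  F/xx r = prodExcept x T (except₂ r)

  F/x*x≡F : ∀ {r} → r < T → F/x r * x r ≡ F
  F/x*x≡F {r} r<T =
    prodExcept-restore x T r<T (dec-true (r ≟ r) refl) refl (λ i i≢r → dec-false (i ≟ r) i≢r)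

  F/xx*x[1+r]≡F/x : ∀ {r} → suc r < T → F/xx r * x (suc r) ≡ F/x r
  F/xx*x[1+r]≡F/x {r} 1+r<T = prodExcept-restore x T 1+r<T
    (trans (cong (does (suc r ≟ r) ∨_) (dec-true (suc r ≟ suc r) refl)) (∨-zeroʳ _))
    (dec-false (suc r ≟ r) 1+n≢n)
    (λ i i≢1+r → trans (cong (does (i ≟ r) ∨_) (dec-false (i ≟ suc r) i≢1+r)) (∨-identityʳ _))

  F/xx*x≡F/x[1+r] : ∀ {r} → suc r < T → F/xx r * x r ≡ F/x (suc r)
  F/xx*x≡F/x[1+r] {r} 1+r<T = prodExcept-restore x T (<-trans (n<1+n r) 1+r<T)
    (cong (_∨ does (r ≟ suc r)) (dec-true (r ≟ r) refl))
    (dec-false (r ≟ suc r) (1+n≢n ∘ ≡-sym))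
    (λ i i≢r → cong (_∨ does (i ≟ suc r)) (dec-false (i ≟ r) i≢r))

  F/x-telescope : ∀ {r} → suc r < T → F/x r ≡ F/x (suc r) + F/xx r
  F/x-telescope {r} 1+r<T = begin
    F/x r                      ≡˘⟨ F/xx*x[1+r]≡F/x 1+r<T ⟩
    F/xx r * (a + suc r)       ≡⟨ cong (F/xx r *_) (+-suc a r) ⟩
    F/xx r * suc (a + r)       ≡⟨ *-suc (F/xx r) (a + r) ⟩
    F/xx r + F/xx r * (a + r)  ≡⟨ cong (F/xx r +_) (F/xx*x≡F/x[1+r] 1+r<T) ⟩
    F/xx r + F/x (suc r)       ≡⟨ +-comm (F/xx r) (F/x (suc r)) ⟩
    F/x (suc r) + F/xx r       ∎
    where open ≡-Reasoning

-- The rationals m/1 < log t and j/1 < log log t (the latter via 2^j < m) witness ExpLt.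
RatioLeF⇒ : ∀ {cn cd s e t m j} → 2 ^ j < m → 2 ^ m < t → RatioLeF cn cd s e t →
  cd * e * m * (j * j) ≤ cn * s
RatioLeF⇒ {cn} {cd} {s} {e} {t} {m} {j} 2^j<m 2^m<t sparse = ≮⇒≥ λ lt →
  sparse (m , 1 , j , 1 , s≤s z≤n , s≤s z≤n , log , (m , 1 , s≤s z≤n , pow , log) , lt′ lt)
  where
  log : LogGt t m 1
  log = subst (2 ^ m <_) (≡-sym (*-identityʳ t)) 2^m<t
  pow : Pow2Lt j 1 m 1
  pow = subst₂ _<_ (≡-sym (*-identityʳ (2 ^ j))) (≡-sym (*-identityʳ m)) 2^j<m
  lt′ : cn * s < cd * e * m * (j * j) → cn * s * 1 * 1 ^ 2 < cd * e * m * j ^ 2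
  lt′ = subst₂ _<_ (≡-sym (trans (*-identityʳ (cn * s * 1)) (*-identityʳ (cn * s))))
                   (cong (λ j² → cd * e * m * j²) (cong (j *_) (≡-sym (*-identityʳ j))))

≤2^2^⇒¬DoubleExpLt : ∀ {X Y k} x → x * Y ≤ X → k ≤ 2 ^ 2 ^ x → ¬ DoubleExpLt X Y k
≤2^2^⇒¬DoubleExpLt {X} {Y} {k} x xY≤X k≤2^2^x (p , q , _ , pow , log) =
  <⇒≱ (^-cancelˡ-< q (begin-strict
    (2 ^ 2 ^ x) ^ q  ≡⟨ ^-*-assoc 2 (2 ^ x) q ⟩
    2 ^ (2 ^ x * q)  ≤⟨ ^-monoʳ-≤ 2 (<⇒≤ 2^x*q<p) ⟩
    2 ^ p            <⟨ log ⟩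
    k ^ q            ∎)) k≤2^2^x
  where
  open ≤-Reasoning
  2^x*q<p : 2 ^ x * q < p
  2^x*q<p = ^-cancelˡ-< Y (begin-strict
    (2 ^ x * q) ^ Y      ≡⟨ ^-distribʳ-* (2 ^ x) q Y ⟩
    (2 ^ x) ^ Y * q ^ Y  ≡⟨ cong (_* q ^ Y) (^-*-assoc 2 x Y) ⟩
    2 ^ (x * Y) * q ^ Y  ≤⟨ *-monoˡ-≤ (q ^ Y) (^-monoʳ-≤ 2 xY≤X) ⟩
    2 ^ X * q ^ Y        <⟨ pow ⟩
    p ^ Y                ∎)

2<2^2^[1+k] : ∀ k → 2 < 2 ^ 2 ^ suc k
2<2^2^[1+k] k = <-≤-trans (s≤s (s≤s (s≤s z≤n))) (^-monoʳ-≤ 2 {2} (*-monoʳ-≤ 2 (m^n>0 2 k)))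

-- The potential

-- Everything is scaled by 2^N · F to stay in ℕ.  On the dyadic block [2^ℓ, 2^(ℓ+1)),
-- ℓ = k₀ + r, the charge D m is 1/(2^ℓ (a + r)(a + r + 1)).  A part of size t sits at
-- level m = logBelow t; the horizon R covers the levels of all parts of size ≤ n.
module Potential (a n : ℕ) where

  k₀ R N : ℕ
  k₀ = suc (suc a)
  R  = ⌊log₂ logBelow n ⌋
  N  = k₀ + R

  open Telescope a (suc (suc R)) public

  blockWeight : ℕ → ℕ
  blockWeight ℓ = 2 ^ (N ∸ ℓ) * F/xx (ℓ ∸ k₀)

  blockWeight-offset : ∀ r → blockWeight (k₀ + r) ≡ 2 ^ (N ∸ (k₀ + r)) * F/xx r
  blockWeight-offset r = cong (λ i → 2 ^ (N ∸ (k₀ + r)) * F/xx i) (m+n∸m≡n k₀ r)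

  2^ℓ*blockWeight : ∀ {r} → k₀ + r ≤ N → 2 ^ (k₀ + r) * blockWeight (k₀ + r) ≡ 2 ^ N * F/xx r
  2^ℓ*blockWeight {r} ℓ≤N = begin
    2 ^ ℓ * blockWeight ℓ           ≡⟨ cong (2 ^ ℓ *_) (blockWeight-offset r) ⟩
    2 ^ ℓ * (2 ^ (N ∸ ℓ) * F/xx r)  ≡˘⟨ *-assoc (2 ^ ℓ) _ (F/xx r) ⟩
    2 ^ ℓ * 2 ^ (N ∸ ℓ) * F/xx r    ≡˘⟨ cong (_* F/xx r) (^-distribˡ-+-* 2 ℓ (N ∸ ℓ)) ⟩
    2 ^ (ℓ + (N ∸ ℓ)) * F/xx r      ≡⟨ cong (λ i → 2 ^ i * F/xx r) (m+[n∸m]≡n ℓ≤N) ⟩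
    2 ^ N * F/xx r                  ∎
    where
    open ≡-Reasoning
    ℓ = k₀ + r

  D : ℕ → ℕ
  D m with 2 ^ k₀ ≤? m
  ... | yes _ = blockWeight ⌊log₂ m ⌋
  ... | no  _ = 0

  D-below : ∀ {m} → m < 2 ^ k₀ → D m ≡ 0
  D-below {m} m<2^k₀ with 2 ^ k₀ ≤? m
  ... | yes 2^k₀≤m = contradiction 2^k₀≤m (<⇒≱ m<2^k₀)
  ... | no  _      = refl

  D-block : ∀ {ℓ m} → k₀ ≤ ℓ → 2 ^ ℓ ≤ m → m < 2 ^ suc ℓ → D m ≡ blockWeight ℓ
  D-block {ℓ} {m} k₀≤ℓ 2^ℓ≤m m<2^1+ℓ with 2 ^ k₀ ≤? m
  ... | yes _      = cong blockWeight (⌊log₂⌋-unique {ℓ} 2^ℓ≤m m<2^1+ℓ)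
  ... | no  2^k₀≰m = contradiction (≤-trans (^-monoʳ-≤ 2 k₀≤ℓ) 2^ℓ≤m) 2^k₀≰m

  Pot : ℕ → ℕ
  Pot zero    = 0
  Pot (suc m) = Pot m + D m

  Pot-mono-≤ : ∀ {m m′} → m ≤ m′ → Pot m ≤ Pot m′
  Pot-mono-≤ m≤m′ = go (≤⇒≤′ m≤m′)
    where
    go : ∀ {m m′} → m ≤′ m′ → Pot m ≤ Pot m′
    go ≤′-refl        = ≤-refl
    go (≤′-step m≤m′) = ≤-trans (go m≤m′) (m≤m+n _ _)

  Pot-below : ∀ {m} → m ≤ 2 ^ k₀ → Pot m ≡ 0
  Pot-below {zero}  _    = refl
  Pot-below {suc m} 1+m≤ = cong₂ _+_ (Pot-below (<⇒≤ 1+m≤)) (D-below 1+m≤)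

  Pot-block : ∀ {ℓ} → k₀ ≤ ℓ → ∀ c → c ≤ 2 ^ ℓ →
    Pot (2 ^ ℓ + c) ≡ Pot (2 ^ ℓ) + c * blockWeight ℓ
  Pot-block {ℓ} k₀≤ℓ zero _ =
    trans (cong Pot (+-identityʳ (2 ^ ℓ))) (≡-sym (+-identityʳ (Pot (2 ^ ℓ))))
  Pot-block {ℓ} k₀≤ℓ (suc c) 1+c≤ = begin
    Pot (2 ^ ℓ + suc c)
      ≡⟨ cong Pot (+-suc (2 ^ ℓ) c) ⟩
    Pot (2 ^ ℓ + c) + D (2 ^ ℓ + c)
      ≡⟨ cong₂ _+_ (Pot-block k₀≤ℓ c (<⇒≤ 1+c≤)) (D-block k₀≤ℓ (m≤m+n _ c) in-block) ⟩
    Pot (2 ^ ℓ) + c * blockWeight ℓ + blockWeight ℓ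
      ≡⟨ +-assoc (Pot (2 ^ ℓ)) _ _ ⟩
    Pot (2 ^ ℓ) + (c * blockWeight ℓ + blockWeight ℓ)
      ≡⟨ cong (Pot (2 ^ ℓ) +_) (+-comm _ (blockWeight ℓ)) ⟩
    Pot (2 ^ ℓ) + suc c * blockWeight ℓ
      ∎
    where
    open ≡-Reasoning
    in-block : 2 ^ ℓ + c < 2 ^ suc ℓ
    in-block = +-monoʳ-< (2 ^ ℓ) (<-≤-trans 1+c≤ (≤-reflexive (≡-sym (+-identityʳ _))))

  Pot-telescope : ∀ r → r ≤ suc R → Pot (2 ^ (k₀ + r)) + 2 ^ N * F/x r ≡ 2 ^ N * F/x 0
  Pot-telescope zero    _         =
    cong (_+ 2 ^ N * F/x 0) (Pot-below (≤-reflexive (cong (2 ^_) (+-identityʳ k₀))))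
  Pot-telescope (suc r) (s≤s r≤R) = begin
    Pot (2 ^ (k₀ + suc r)) + 2 ^ N * F/x (suc r)
      ≡⟨ cong (λ p → Pot p + 2 ^ N * F/x (suc r)) doubling ⟩
    Pot (2 ^ ℓ + 2 ^ ℓ) + 2 ^ N * F/x (suc r)
      ≡⟨ cong (_+ 2 ^ N * F/x (suc r)) (Pot-block {ℓ} (m≤m+n k₀ r) (2 ^ ℓ) ≤-refl) ⟩
    Pot (2 ^ ℓ) + 2 ^ ℓ * blockWeight ℓ + 2 ^ N * F/x (suc r)
      ≡⟨ cong (λ w → Pot (2 ^ ℓ) + w + 2 ^ N * F/x (suc r)) (2^ℓ*blockWeight (+-monoʳ-≤ k₀ r≤R)) ⟩
    Pot (2 ^ ℓ) + 2 ^ N * F/xx r + 2 ^ N * F/x (suc r)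
      ≡⟨ collect (Pot (2 ^ ℓ)) (2 ^ N) (F/xx r) (F/x (suc r)) ⟩
    Pot (2 ^ ℓ) + 2 ^ N * (F/x (suc r) + F/xx r)
      ≡˘⟨ cong (λ g → Pot (2 ^ ℓ) + 2 ^ N * g) (F/x-telescope (s≤s (s≤s r≤R))) ⟩
    Pot (2 ^ ℓ) + 2 ^ N * F/x r
      ≡⟨ Pot-telescope r (m≤n⇒m≤1+n r≤R) ⟩
    2 ^ N * F/x 0
      ∎
    where
    open ≡-Reasoning
    ℓ = k₀ + r
    doubling : 2 ^ (k₀ + suc r) ≡ 2 ^ ℓ + 2 ^ ℓ
    doubling = trans (cong (2 ^_) (+-suc k₀ r)) (cong (2 ^ ℓ +_) (+-identityʳ (2 ^ ℓ)))
    collect : ∀ p x w g → p + x * w + x * g ≡ p + x * (g + w)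
    collect = solve-∀

  Pot-bound : ∀ {m} → m ≤ 2 ^ suc N → Pot m ≤ 2 ^ N * F/x 0
  Pot-bound {m} m≤2^1+N = begin
    Pot m                                         ≤⟨ Pot-mono-≤ m≤2^[k₀+1+R] ⟩
    Pot (2 ^ (k₀ + suc R))                        ≤⟨ m≤m+n _ _ ⟩
    Pot (2 ^ (k₀ + suc R)) + 2 ^ N * F/x (suc R)  ≡⟨ Pot-telescope (suc R) ≤-refl ⟩
    2 ^ N * F/x 0                                 ∎
    where
    open ≤-Reasoning
    m≤2^[k₀+1+R] = subst (m ≤_) (cong (2 ^_) (≡-sym (+-suc k₀ R))) m≤2^1+N

  Φ : ℕ → ℕ
  Φ t = Pot (suc (logBelow t))

  Φ-mono-≤ : ∀ {s t} → s ≤ t → Φ s ≤ Φ t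
  Φ-mono-≤ s≤t = Pot-mono-≤ (s≤s (logBelow-mono-≤ s≤t))

  a*Φn≤2^N*F : a * Φ n ≤ 2 ^ N * F
  a*Φn≤2^N*F = begin
    a * Φ n              ≤⟨ *-monoʳ-≤ a (Pot-bound level-n≤) ⟩
    a * (2 ^ N * F/x 0)  ≡⟨ rotate a (2 ^ N) (F/x 0) ⟩
    2 ^ N * (F/x 0 * a)  ≡⟨ cong (2 ^ N *_) (trans (cong (F/x 0 *_) (≡-sym (+-identityʳ a)))
                                                   (F/x*x≡F (s≤s z≤n))) ⟩
    2 ^ N * F            ∎
    where
    open ≤-Reasoning
    level-n≤ : suc (logBelow n) ≤ 2 ^ suc N
    level-n≤ = ≤-trans (<2^suc⌊log₂⌋ (logBelow n)) (^-monoʳ-≤ 2 (s≤s (m≤n+m R k₀)))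
    rotate : ∀ a p g → a * (p * g) ≡ p * (g * a)
    rotate = solve-∀

  block-pays : ∀ {cn cd s e t m r} → 2 ^ (k₀ + r) ≤ m → 2 ^ m < t → r ≤ R →
    RatioLeF cn cd s e t → e * (cd * (2 ^ N * F)) ≤ cn * s * (2 ^ (N ∸ (k₀ + r)) * F/xx r)
  block-pays {cn} {cd} {s} {e} {t} {m} {r} 2^ℓ≤m 2^m<t r≤R sparse = begin
    e * (cd * (2 ^ N * F))
      ≡⟨ cong₂ (λ p f → e * (cd * (p * f))) 2^N≡ F≡ ⟩
    e * (cd * (2 ^ ℓ * P * (F/xx r * j * x r)))
      ≤⟨ *-monoʳ-≤ e (*-monoʳ-≤ cd (*-mono-≤ (*-monoˡ-≤ P 2^ℓ≤m) (*-monoʳ-≤ (F/xx r * j) x≤j))) ⟩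
    e * (cd * (m * P * (F/xx r * j * j)))
      ≡⟨ regroup e cd m P (F/xx r) j ⟩
    cd * e * m * (j * j) * (P * F/xx r)
      ≤⟨ *-monoˡ-≤ (P * F/xx r) (RatioLeF⇒ {cn} {cd} {s} {e} {t} {m} {j} 2^j<m 2^m<t sparse) ⟩
    cn * s * (P * F/xx r)
      ∎
    where
    open ≤-Reasoning
    ℓ = k₀ + r
    j = suc (a + r)
    P = 2 ^ (N ∸ ℓ)
    x≤j : x r ≤ j
    x≤j = n≤1+n (x r)
    2^N≡ : 2 ^ N ≡ 2 ^ ℓ * P
    2^N≡ = trans (cong (2 ^_) (≡-sym (m+[n∸m]≡n (+-monoʳ-≤ k₀ r≤R)))) (^-distribˡ-+-* 2 ℓ (N ∸ ℓ))
    F≡ : F ≡ F/xx r * j * x r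
    F≡ = trans (≡-sym (F/x*x≡F (s≤s (m≤n⇒m≤1+n r≤R))))
               (cong (_* x r) (trans (≡-sym (F/xx*x[1+r]≡F/x (s≤s (s≤s r≤R))))
                                     (cong (F/xx r *_) (+-suc a r))))
    2^j<m : 2 ^ j < m
    2^j<m = <-≤-trans (^-monoʳ-< 2 (s≤s (s≤s z≤n)) (n<1+n j)) 2^ℓ≤m
    regroup : ∀ e cd m P w j → e * (cd * (m * P * (w * j * j))) ≡ cd * e * m * (j * j) * (P * w)
    regroup = solve-∀

  charge : ∀ cn cd {s e t} → t ≤ n → 2 ^ 2 ^ k₀ < t → 2 * s ≤ t → RatioLeF cn cd s e t →
    e * (cd * (2 ^ N * F)) + cn * s * Φ s ≤ cn * s * Φ t
  charge cn cd {s} {e} {t} t≤n K<t 2s≤t sparse = begin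
    e * (cd * (2 ^ N * F)) + cn * s * Φ s
      ≤⟨ +-monoˡ-≤ (cn * s * Φ s) (block-pays {cn} {cd} {s} {e} {t} 2^ℓ≤m 2^m<t r≤R sparse) ⟩
    cn * s * (2 ^ (N ∸ (k₀ + r)) * F/xx r) + cn * s * Φ s
      ≡˘⟨ cong (λ d → cn * s * d + cn * s * Φ s) Dm≡ ⟩
    cn * s * D m + cn * s * Φ s
      ≡˘⟨ *-distribˡ-+ (cn * s) (D m) (Φ s) ⟩
    cn * s * (D m + Φ s)
      ≤⟨ *-monoʳ-≤ (cn * s) (+-monoʳ-≤ (D m) (Pot-mono-≤ (logBelow-half {s} {t} 2s≤t 1≤m))) ⟩
    cn * s * (D m + Pot m)
      ≡⟨ cong (cn * s *_) (+-comm (D m) (Pot m)) ⟩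
    cn * s * Φ t
      ∎
    where
    open ≤-Reasoning
    m = logBelow t
    2^k₀≤m : 2 ^ k₀ ≤ m
    2^k₀≤m = logBelow-greatest K<t
    1≤m : 1 ≤ m
    1≤m = ≤-trans (m^n>0 2 k₀) 2^k₀≤m
    2^m<t : 2 ^ m < t
    2^m<t = 2^logBelow< (≤-trans (s≤s (m^n>0 2 (2 ^ k₀))) K<t)
    r = ⌊log₂ m ⌋ ∸ k₀
    k₀+r≡ : k₀ + r ≡ ⌊log₂ m ⌋
    k₀+r≡ = m+[n∸m]≡n (⌊log₂⌋-greatest 2^k₀≤m)
    2^ℓ≤m : 2 ^ (k₀ + r) ≤ m
    2^ℓ≤m = subst (λ ℓ → 2 ^ ℓ ≤ m) (≡-sym k₀+r≡) (2^⌊log₂⌋≤ 1≤m)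
    m<2^[ℓ+1] : m < 2 ^ suc (k₀ + r)
    m<2^[ℓ+1] = subst (λ ℓ → m < 2 ^ suc ℓ) (≡-sym k₀+r≡) (<2^suc⌊log₂⌋ m)
    r≤R : r ≤ R
    r≤R = ≤-trans (m∸n≤m ⌊log₂ m ⌋ k₀) (⌊log₂⌋-mono-≤ (logBelow-mono-≤ t≤n))
    Dm≡ : D m ≡ 2 ^ (N ∸ (k₀ + r)) * F/xx r
    Dm≡ = trans (D-block (m≤m+n k₀ r) 2^ℓ≤m m<2^[ℓ+1]) (blockWeight-offset r)

  scaled-cost-bound : ∀ c cn cd en ed → 0 < a → 0 < cd →
    c * (cd * (2 ^ N * F)) ≤ cn * n * Φ n → cn * ed ≤ a * (cd * en) → c * ed ≤ en * n
  scaled-cost-bound c cn cd en ed 0<a 0<cd cost C/ε≤a =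
    *-cancelʳ-≤ (c * ed) (en * n) (a * (cd * P)) {{>-nonZero 0<a*cd*P}} (begin
      c * ed * (a * (cd * P))  ≡⟨ e₁ c ed a (cd * P) ⟩
      a * ed * (c * (cd * P))  ≤⟨ *-monoʳ-≤ (a * ed) cost ⟩
      a * ed * (cn * n * Φ n)  ≡⟨ e₂ a ed cn n (Φ n) ⟩
      cn * ed * n * (a * Φ n)  ≤⟨ *-monoʳ-≤ (cn * ed * n) a*Φn≤2^N*F ⟩
      cn * ed * n * P          ≤⟨ *-monoˡ-≤ P (*-monoˡ-≤ n C/ε≤a) ⟩
      a * (cd * en) * n * P    ≡⟨ e₃ a cd en n P ⟩
      en * n * (a * (cd * P))  ∎)
    where
    open ≤-Reasoning
    P = 2 ^ N * F
    0<a*cd*P : 0 < a * (cd * P)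
    0<a*cd*P = *-mono-≤ 0<a (*-mono-≤ 0<cd (*-mono-≤ (m^n>0 2 N) (F-pos 0<a)))
    e₁ : ∀ c ed a Q → c * ed * (a * Q) ≡ a * ed * (c * Q)
    e₁ = solve-∀
    e₂ : ∀ a ed cn n φ → a * ed * (cn * n * φ) ≡ cn * ed * n * (a * φ)
    e₂ = solve-∀
    e₃ : ∀ a cd en n P → a * (cd * en) * n * P ≡ en * n * (a * (cd * P))
    e₃ = solve-∀

-- With C = cn/cd and ε = en/ed, a is the least integer above 2C/ε.
module Constants (cn cd en ed : ℕ) .{{_ : NonZero (cd * en)}} where

  q a : ℕ
  q = (2 * cn * ed) / (cd * en)
  a = suc q

  C/ε≤a : cn * ed ≤ a * (cd * en)
  C/ε≤a = begin
    cn * ed                                 ≤⟨ *-monoˡ-≤ ed (m≤n*m cn 2) ⟩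
    2 * cn * ed                             ≡⟨ m≡m%n+[m/n]*n (2 * cn * ed) (cd * en) ⟩
    2 * cn * ed % (cd * en) + q * (cd * en) ≤⟨ +-monoˡ-≤ (q * (cd * en)) remainder≤ ⟩
    a * (cd * en)                           ∎
    where
    open ≤-Reasoning
    remainder≤ = <⇒≤ (m%n<n (2 * cn * ed) (cd * en))

  2+a≤2C/ε+3 : (2 + a) * (cd * en) ≤ 2 * cn * ed + 3 * cd * en
  2+a≤2C/ε+3 = begin
    (3 + q) * (cd * en)          ≡⟨ expand q cd en ⟩
    q * (cd * en) + 3 * cd * en  ≤⟨ +-monoˡ-≤ (3 * cd * en) (m/n*n≤m (2 * cn * ed) (cd * en)) ⟩
    2 * cn * ed + 3 * cd * en    ∎
    where
    open ≤-Reasoning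
    expand : ∀ q c e → (3 + q) * (c * e) ≡ q * (c * e) + 3 * c * e
    expand = solve-∀

lemma3p2 : (cn cd en ed : ℕ) → 0 < cn → 0 < cd → 0 < en → 0 < ed →
    (n : ℕ) (G : Graph n) → NonExpanding cn cd G →
    Σ (Graph n) λ G' → SpanningSub G' G ×
      (removedEdges G G' * ed ≤ en * n) ×
      ((v : Fin n) (U : Subset n) → ((u : Fin n) → u ∈ U → Reach G' v u) →
        SizeBound cn cd en ed (∣ U ∣))
lemma3p2 cn cd en ed _ 0<cd 0<en _ n G non-expanding =
  let G′ , spanning , cost , small = decomposition in
  G′ , spanning , scaled-cost-bound (removedEdges G G′) cn cd en ed (s≤s z≤n) 0<cd cost C/ε≤a ,
  λ v U reach → ≤2^2^⇒¬DoubleExpLt {Y = cd * en} k₀ 2+a≤2C/ε+3 (small v U reach)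
  where
  instance
    cd*en≢0 : NonZero (cd * en)
    cd*en≢0 = >-nonZero (*-mono-≤ 0<cd 0<en)
  open Constants cn cd en ed
  open Potential a n
  open Decompose G cn cd non-expanding (2 ^ 2 ^ k₀) (cd * (2 ^ N * F)) (2<2^2^[1+k] (suc a))
    Φ Φ-mono-≤ (charge cn cd)
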